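{- Let $L$ be a finite poset, $u:P\to L$ an $L$-evaluation and $n\in\omega$. Then $\downarrow_n u$ is the least subpresheaf of $h_L$ having b$^{\le}$-index $n$ such that $u\in(\downarrow_n u)_P$. Moreover, a subpresheaf $S$ of $h_L$ has b$^{\le}$-index $n$ if and only if, for each $L$-evaluation $w:R\to L$ with $w\in S_R$, $\downarrow_n w\subseteq S$.
   Context: $\mathbf P_0$: category of finite posets with a greatest element (root $\rho(P)$) and open (p-)morphisms $h:Q\to P$ (order-preserving, and whenever $p'\le h(q)$ there is $q'\le q$ with $h(q')=p'$). $\downarrow p=\{p'\le p\}$. For a finite poset $L$, $h_L$ is the presheaf on $\mathbf P_0$ with $h_L(P)$ the order-preserving maps $u:P\to L$ ($L$-evaluations) and restriction $u\mapsto u\circ h$; $u_p$ is the restriction of $u$ to $\downarrow p$. $u\sim_0 v$ iff $u(\rho(P))=v(\rho(Q))$; $u\sim_{n+1}v$ iff every $p\in P$ has $q\in Q$ with $u_p\sim_n v_q$ and every $q\in Q$ has $p\in P$ with $u_p\sim_n v_q$. $v\le_0 u$ iff $v(\rho(Q))\le u(\rho(P))$; $v\le_{n+1}u$ iff for every $q\in Q$ there is $p\in P$ with $v_q\sim_n u_p$. A subpresheaf $S\subseteq h_L$ has b$^{\le}$-index $n$ if for all $u\in S_P$ and $v:Q\to L$ with $v\le_n u$ we have $v\in S_Q$. For $u:P\to L$, $\downarrow_n u$ is the subpresheaf with $(\downarrow_n u)_Q=\{v:Q\to L\mid v\le_n u\}$. -}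

module Defs where

open import Level using (0ℓ)
open import Data.Nat using (ℕ; zero; suc)
open import Data.Fin using (Fin)
open import Data.Product using (Σ; ∃; ∃-syntax; _×_; _,_)
open import Relation.Binary.Core using (Rel)
open import Relation.Binary.Structures using (IsPartialOrder)
open import Relation.Binary.PropositionalEquality using (_≡_)
open import Function.Bundles using (_⇔_)

record FinPoset : Set₁ where
  field
    size           : ℕ
    _≤_            : Rel (Fin size) 0ℓ
    isPartialOrder : IsPartialOrder _≡_ _≤_

open FinPoset public

Carrier : FinPoset → Set
Carrier L = Fin (size L)

-- Objects of P₀: finite posets with a greatest element (the root ρ(P)).
record RootedPoset : Set₁ where
  field
    poset    : FinPoset
    root     : Carrier poset
    root-top : ∀ p → _≤_ poset p root

open RootedPoset public

Pt : RootedPoset → Set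
Pt P = Carrier (poset P)

record OpenMap (Q P : RootedPoset) : Set where
  field
    fun  : Pt Q → Pt P
    mono : ∀ {q q'} → _≤_ (poset Q) q q' → _≤_ (poset P) (fun q) (fun q')
    isOpen : ∀ q p' → _≤_ (poset P) p' (fun q) →
           ∃[ q' ] (_≤_ (poset Q) q' q × fun q' ≡ p')

open OpenMap public

-- L-evaluations u : P → L (order-preserving maps); elements of h_L(P).
record Eval (P : RootedPoset) (L : FinPoset) : Set where
  field
    ev   : Pt P → Carrier L
    mono : ∀ {p p'} → _≤_ (poset P) p p' → _≤_ L (ev p) (ev p')

open Eval public

restrict : ∀ {L Q P} → OpenMap Q P → Eval P L → Eval Q L
restrict h u = record { ev = λ q → ev u (fun h q)
                      ; mono = λ q≤q' → Eval.mono u (OpenMap.mono h q≤q') }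

-- u_p ~ₙ v_q, where u_p is the restriction of u to ↓p (a rooted poset with
-- root p; its points are the p' ≤ p, and (u_p)_{p'} = u_{p'}).
Sim : ∀ {L} → ℕ → {P : RootedPoset} → Eval P L → Pt P →
               {Q : RootedPoset} → Eval Q L → Pt Q → Set
Sim zero    u p v q = ev u p ≡ ev v q
Sim {L} (suc n) {P} u p {Q} v q =
    (∀ p' → _≤_ (poset P) p' p → ∃[ q' ] (_≤_ (poset Q) q' q × Sim {L} n u p' v q'))
  × (∀ q' → _≤_ (poset Q) q' q → ∃[ p' ] (_≤_ (poset P) p' p × Sim {L} n u p' v q'))

_~[_]_ : ∀ {L P Q} → Eval P L → ℕ → Eval Q L → Set
_~[_]_ {P = P} {Q} u n v = Sim n u (root P) v (root Q)

_≤[_]_ : ∀ {L Q P} → Eval Q L → ℕ → Eval P L → Set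
_≤[_]_ {L} {Q} {P} v zero    u = _≤_ L (ev v (root Q)) (ev u (root P))
_≤[_]_ {L} {Q} {P} v (suc n) u = ∀ q → ∃[ p ] Sim n v q u p

Family : FinPoset → Set₁
Family L = (P : RootedPoset) → Eval P L → Set

IsSubpresheaf : ∀ {L} → Family L → Set₁
IsSubpresheaf {L} S = ∀ {Q P} (h : OpenMap Q P) (u : Eval P L) → S P u → S Q (restrict h u)

HasIndex : ∀ {L} → ℕ → Family L → Set₁
HasIndex {L} n S = ∀ {P Q} (u : Eval P L) (v : Eval Q L) → S P u → v ≤[ n ] u → S Q v

_⊆_ : ∀ {L} → Family L → Family L → Set₁
_⊆_ {L} S T = ∀ Q (v : Eval Q L) → S Q v → T Q v

↓[_]_ : ∀ {L P} → ℕ → Eval P L → Family L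
↓[_]_ n u Q v = v ≤[ n ] u

-- Both ~ₙ and ≤ₙ are preorders, and ≤ₙ is stable under restriction along open
-- maps, since openness lifts the back half of the back-and-forth condition
-- through h. So ↓ₙ u is a subpresheaf that is downward closed under ≤ₙ; minimality
-- and the characterisation of index n are then just unfoldings of HasIndex.
module Submission where

open import Defs
open import Data.Nat using (ℕ; zero; suc)
open import Data.Product using (_×_; _,_)
open import Function.Bundles using (_⇔_; mk⇔)
open import Relation.Binary.PropositionalEquality using (refl; trans; sym; subst)
open import Relation.Binary.Structures using (IsPartialOrder)

module _ {L : FinPoset} where
  open IsPartialOrder (isPartialOrder L) using ()
    renaming (refl to ≤L-refl; trans to ≤L-trans)

  Sim-refl : ∀ n {P : RootedPoset} (u : Eval P L) p → Sim n u p u p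
  Sim-refl zero    u p = refl
  Sim-refl (suc n) u p = (λ p' p'≤p → p' , p'≤p , Sim-refl n u p')
                       , (λ p' p'≤p → p' , p'≤p , Sim-refl n u p')

  Sim-trans : ∀ n {P Q R : RootedPoset} {u : Eval P L} {v : Eval Q L} {w : Eval R L} {p q r} →
              Sim n u p v q → Sim n v q w r → Sim n u p w r
  Sim-trans zero    u~v v~w = trans u~v v~w
  Sim-trans (suc n) (uv-forth , uv-back) (vw-forth , vw-back) = forth , back
    where
    forth = λ p' p'≤p →
      let (q' , q'≤q , u~v) = uv-forth p' p'≤p
          (r' , r'≤r , v~w) = vw-forth q' q'≤q
      in r' , r'≤r , Sim-trans n u~v v~w
    back = λ r' r'≤r →
      let (q' , q'≤q , v~w) = vw-back r' r'≤r
          (p' , p'≤p , u~v) = uv-back q' q'≤q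
      in p' , p'≤p , Sim-trans n u~v v~w

  Sim-restrict : ∀ n {Q P R : RootedPoset} (h : OpenMap Q P) {v : Eval P L} {u : Eval R L} q {r} →
                 Sim n v (fun h q) u r → Sim n (restrict h v) q u r
  Sim-restrict zero    h q v~u = v~u
  Sim-restrict (suc n) h {v} {u} q (forth , back) = forth′ , back′
    where
    forth′ = λ q' q'≤q →
      let (r' , r'≤r , v~u) = forth (fun h q') (OpenMap.mono h q'≤q)
      in r' , r'≤r , Sim-restrict n h q' v~u
    back′ = λ r' r'≤r →
      let (p' , p'≤hq , v~u) = back r' r'≤r
          (q' , q'≤q , hq'≡p') = isOpen h q p' p'≤hq
      in q' , q'≤q , Sim-restrict n h q' (subst (λ x → Sim n v x u r') (sym hq'≡p') v~u)

  ≤ₙ-refl : ∀ n {P : RootedPoset} (u : Eval P L) → u ≤[ n ] u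
  ≤ₙ-refl zero    u = ≤L-refl
  ≤ₙ-refl (suc n) u p = p , Sim-refl n u p

  ≤ₙ-trans : ∀ n {P Q R : RootedPoset} {w : Eval R L} {v : Eval Q L} {u : Eval P L} →
             w ≤[ n ] v → v ≤[ n ] u → w ≤[ n ] u
  ≤ₙ-trans zero    w≤v v≤u = ≤L-trans w≤v v≤u
  ≤ₙ-trans (suc n) w≤v v≤u r =
    let (q , w~v) = w≤v r
        (p , v~u) = v≤u q
    in p , Sim-trans n w~v v~u

  -- At level 0 the root of Q is mapped below the root of P, and v is monotone.
  ≤ₙ-restrict : ∀ n {Q P R : RootedPoset} (h : OpenMap Q P) {v : Eval P L} {u : Eval R L} →
                v ≤[ n ] u → restrict h v ≤[ n ] u
  ≤ₙ-restrict zero    {Q} {P} h {v} v≤u = ≤L-trans (Eval.mono v (root-top P (fun h (root Q)))) v≤u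
  ≤ₙ-restrict (suc n) h v≤u q =
    let (p , v~u) = v≤u (fun h q) in p , Sim-restrict n h q v~u

  ↓-isSubpresheaf : ∀ n {P} (u : Eval P L) → IsSubpresheaf (↓[ n ] u)
  ↓-isSubpresheaf n u h v = ≤ₙ-restrict n h

  ↓-hasIndex : ∀ n {P} (u : Eval P L) → HasIndex n (↓[ n ] u)
  ↓-hasIndex n u v w v≤u w≤v = ≤ₙ-trans n w≤v v≤u

  hasIndex⇒↓⊆ : ∀ n (S : Family L) → HasIndex n S →
                ∀ R (w : Eval R L) → S R w → (↓[ n ] w) ⊆ S
  hasIndex⇒↓⊆ n S index R w w∈S Q v v≤w = index w v w∈S v≤w

  ↓⊆⇒hasIndex : ∀ n (S : Family L) →
                (∀ R (w : Eval R L) → S R w → (↓[ n ] w) ⊆ S) → HasIndex n S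
  ↓⊆⇒hasIndex n S ↓⊆S w v w∈S v≤w = ↓⊆S _ w w∈S _ v v≤w

mainTheorem5 : (L : FinPoset) (P : RootedPoset) (u : Eval P L) (n : ℕ) →
    (IsSubpresheaf (↓[ n ] u) × HasIndex n (↓[ n ] u) × (↓[ n ] u) P u
    × ((S : Family L) → IsSubpresheaf S → HasIndex n S → S P u → (↓[ n ] u) ⊆ S))
    × ((S : Family L) → IsSubpresheaf S →
    (HasIndex n S ⇔ ((R : RootedPoset) (w : Eval R L) → S R w → (↓[ n ] w) ⊆ S)))
mainTheorem5 L P u n =
  ( ↓-isSubpresheaf n u
  , ↓-hasIndex n u
  , ≤ₙ-refl n u
  , (λ S _ index → hasIndex⇒↓⊆ n S index P u) )
  , λ S _ → mk⇔ (hasIndex⇒↓⊆ n S) (↓⊆⇒hasIndex n S)
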